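{- For every integer $n\ge0$, the number of words $w\in F(n)$ with $f_w$ odd is $2^{\lfloor n/2\rfloor}$.
   Context: For $n\ge 0$, let $F(n)$ be the set of all words $w=x_1\dotsb x_l$ with each $x_i\in\{1,2\}$ and $\sum_i x_i=n$, and $F=\coprod_{n\ge0}F(n)$ ($F(0)$ contains only the empty word $\emptyset$). The Young–Fibonacci graph has vertex set $F$, with an edge between $v\in F(n)$ and $w\in F(n+1)$ (written $v\in w^-$) iff either (1) $v$ is obtained from $w$ by changing into a $1$ some $2$ of $w$ that has no $1$ to its left, or (2) $v$ is obtained from $w$ by removing its leftmost $1$. The $f$-statistic is defined recursively by $f_\emptyset=1$ and $f_w=\sum_{v\in w^- }f_v$. -}

module Defs where

open import Data.Nat using (ℕ; zero; suc; _+_)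
open import Data.List using (List; []; _∷_; map; _++_)
open import Data.Nat.ListAction using (sum)
open import Data.Maybe using (Maybe; just; nothing)

data Letter : Set where
  one two : Letter

val : Letter → ℕ
val one = 1
val two = 2

Word : Set
Word = List Letter

weight : Word → ℕ
weight [] = 0
weight (x ∷ w) = val x + weight w

-- F(n): all words of weight n (each exactly once)
F : ℕ → List Word
F zero = []  ∷ []
F (suc zero) = (one ∷ []) ∷ []
F (suc (suc n)) = map (one ∷_) (F (suc n)) ++ map (two ∷_) (F n)

-- Rule (1): words obtained by changing into a 1 some 2 that has no 1 to its left.
changeTwo : Word → List Word
changeTwo [] = []
changeTwo (one ∷ w) = []
changeTwo (two ∷ w) = (one ∷ w) ∷ map (two ∷_) (changeTwo w)

removeLeftmostOne : Word → Maybe Word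
removeLeftmostOne [] = nothing
removeLeftmostOne (one ∷ w) = just w
removeLeftmostOne (two ∷ w) = Data.Maybe.map (two ∷_) (removeLeftmostOne w)

maybeToList : {A : Set} → Maybe A → List A
maybeToList nothing = []
maybeToList (just a) = a ∷ []

-- w⁻ : the lower neighbours of w (these words are pairwise distinct:
-- rule (1) outputs have length |w| and differ in position, rule (2) output has length |w|-1)
down : Word → List Word
down w = changeTwo w ++ maybeToList (removeLeftmostOne w)

-- f-statistic, computed with fuel; fuel ≥ weight w suffices since
-- every element of w⁻ has weight one less than w.
fAux : ℕ → Word → ℕ
fAux zero w = 1
fAux (suc k) [] = 1
fAux (suc k) (x ∷ w) = sum (map (fAux k) (down (x ∷ w)))

f : Word → ℕ
f w = fAux (weight w) w

-- Unwinding the recursion gives the product formula f(1w) = f(w), f(2w) = (|w| + 1) f(w),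
-- where |w| is the weight.  Hence f(2w) is odd exactly when f(w) is odd and |w| is even, so the
-- number c(n) of odd words of weight n satisfies c(n+2) = c(n+1) + [n even] c(n), c(0) = c(1) = 1,
-- whose solution is c(2k) = c(2k+1) = 2^k.
module Submission where

open import Defs
open import Data.Nat using (ℕ; _^_; _/_; _%_; _≟_)
open import Data.List using (length; filter)
open import Relation.Binary.PropositionalEquality using (_≡_)

open import Data.Nat using (zero; suc; _+_; _*_; _≤_; s≤s)
open import Data.Nat.Properties using (+-identityʳ; *-zeroʳ; *-distribˡ-+; *-mono-≤; ≤-pred; ≤-refl)
open import Data.Nat.DivMod using (m%n<n; m<n⇒m%n≡m; %-distribˡ-*; [m+kn]%n≡m%n; m*n%n≡0; m≡m%n+[m/n]*n)
open import Data.Nat.ListAction using (sum)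
open import Data.Nat.ListAction.Properties using (sum-++)
open import Data.List using ([]; _∷_; map; _++_)
open import Data.List.Properties using (map-++; map-∘; map-cong; map-cong-local)
open import Data.List.Relation.Unary.All using (All; []; _∷_)
import Data.List.Relation.Unary.All as All
open import Data.List.Relation.Unary.All.Properties using (++⁺; gmap⁺)
open import Data.Maybe using (just; nothing)
import Data.Maybe as Maybe
open import Data.Product using (_×_; _,_; proj₁; proj₂)
open import Data.Sum using (_⊎_; inj₁; inj₂)
open import Function using (_∘_)
open import Relation.Binary.PropositionalEquality
  using (refl; sym; trans; cong; cong₂; subst; module ≡-Reasoning)
open ≡-Reasoning

down-two : ∀ w → down (two ∷ w) ≡ (one ∷ w) ∷ map (two ∷_) (down w)
down-two w = cong ((one ∷ w) ∷_) (begin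
  map (two ∷_) (changeTwo w) ++ maybeToList (Maybe.map (two ∷_) (removeLeftmostOne w))
    ≡⟨ cong (map (two ∷_) (changeTwo w) ++_) (maybeToList-map (removeLeftmostOne w)) ⟩
  map (two ∷_) (changeTwo w) ++ map (two ∷_) (maybeToList (removeLeftmostOne w))
    ≡⟨ map-++ (two ∷_) (changeTwo w) _ ⟨
  map (two ∷_) (down w) ∎)
  where
  maybeToList-map : ∀ m → maybeToList (Maybe.map (two ∷_) m) ≡ map (two ∷_) (maybeToList m)
  maybeToList-map nothing  = refl
  maybeToList-map (just v) = refl

weight-down : ∀ w → All (λ v → suc (weight v) ≡ weight w) (down w)
weight-down []        = []
weight-down (one ∷ w) = refl ∷ []
weight-down (two ∷ w) rewrite down-two w =
  refl ∷ gmap⁺ (cong (2 +_)) (weight-down w)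

sum-map-*ˡ : ∀ {A : Set} c (g : A → ℕ) xs → sum (map (λ x → c * g x) xs) ≡ c * sum (map g xs)
sum-map-*ˡ c g []       = sym (*-zeroʳ c)
sum-map-*ˡ c g (x ∷ xs) = trans (cong (c * g x +_) (sum-map-*ˡ c g xs))
                                (sym (*-distribˡ-+ c (g x) _))

fProduct : Word → ℕ
fProduct []        = 1
fProduct (one ∷ w) = fProduct w
fProduct (two ∷ w) = suc (weight w) * fProduct w

mutual
  fProduct-down : ∀ x w → sum (map fProduct (down (x ∷ w))) ≡ fProduct (x ∷ w)
  fProduct-down one w = +-identityʳ (fProduct w)
  fProduct-down two w = begin
    sum (map fProduct (down (two ∷ w)))
      ≡⟨ cong (sum ∘ map fProduct) (down-two w) ⟩
    fProduct w + sum (map fProduct (map (two ∷_) (down w)))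
      ≡⟨ cong (λ vs → fProduct w + sum vs) (map-∘ (down w)) ⟨
    fProduct w + sum (map (λ v → suc (weight v) * fProduct v) (down w))
      ≡⟨ cong (λ vs → fProduct w + sum vs) (map-cong-local (All.map (cong (_* _)) (weight-down w))) ⟩
    fProduct w + sum (map (λ v → weight w * fProduct v) (down w))
      ≡⟨ cong (fProduct w +_) (sum-map-*ˡ (weight w) fProduct (down w)) ⟩
    fProduct w + weight w * sum (map fProduct (down w))
      ≡⟨ cong (fProduct w +_) (weight*fProduct-down w) ⟩
    fProduct w + weight w * fProduct w ∎

  weight*fProduct-down : ∀ w → weight w * sum (map fProduct (down w)) ≡ weight w * fProduct w
  weight*fProduct-down []      = refl
  weight*fProduct-down (x ∷ w) = cong (weight (x ∷ w) *_) (fProduct-down x w)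

fAux≡fProduct : ∀ k w → weight w ≤ k → fAux k w ≡ fProduct w
fAux≡fProduct zero    []        _ = refl
fAux≡fProduct zero    (one ∷ w) ()
fAux≡fProduct zero    (two ∷ w) ()
fAux≡fProduct (suc k) []        _ = refl
fAux≡fProduct (suc k) (x ∷ w) w≤k = trans
  (cong sum (map-cong-local (All.map fuelled (weight-down (x ∷ w)))))
  (fProduct-down x w)
  where
  fuelled : ∀ {v} → suc (weight v) ≡ weight (x ∷ w) → fAux k v ≡ fProduct v
  fuelled {v} eq = fAux≡fProduct k v (≤-pred (subst (_≤ suc k) (sym eq) w≤k))

f≡fProduct : ∀ w → f w ≡ fProduct w
f≡fProduct w = fAux≡fProduct (weight w) w ≤-refl

f-one : ∀ w → f (one ∷ w) ≡ f w
f-one w = trans (f≡fProduct (one ∷ w)) (sym (f≡fProduct w))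

f-two : ∀ w → f (two ∷ w) ≡ suc (weight w) * f w
f-two w = trans (f≡fProduct (two ∷ w)) (cong (suc (weight w) *_) (sym (f≡fProduct w)))

F-weight : ∀ n → All (λ w → weight w ≡ n) (F n)
F-weight zero          = refl ∷ []
F-weight (suc zero)    = refl ∷ []
F-weight (suc (suc n)) = ++⁺ (gmap⁺ (cong suc) (F-weight (suc n)))
                             (gmap⁺ (cong (2 +_)) (F-weight n))

m%2≡0⊎m%2≡1 : ∀ m → m % 2 ≡ 0 ⊎ m % 2 ≡ 1
m%2≡0⊎m%2≡1 m with m % 2 | m%n<n m 2
... | 0 | _ = inj₁ refl
... | 1 | _ = inj₂ refl
... | suc (suc _) | s≤s (s≤s ())

[m*n]%2≡[m%2]*[n%2] : ∀ m n → (m * n) % 2 ≡ (m % 2) * (n % 2)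
[m*n]%2≡[m%2]*[n%2] m n = trans (%-distribˡ-* m n 2)
  (m<n⇒m%n≡m (s≤s (*-mono-≤ (≤-pred (m%n<n m 2)) (≤-pred (m%n<n n 2)))))

length-filter-odd : ∀ {A : Set} (g : A → ℕ) xs →
  length (filter (λ x → g x % 2 ≟ 1) xs) ≡ sum (map (λ x → g x % 2) xs)
length-filter-odd g []       = refl
length-filter-odd g (x ∷ xs) with g x % 2 | m%2≡0⊎m%2≡1 (g x)
... | _ | inj₁ refl = length-filter-odd g xs
... | _ | inj₂ refl = cong suc (length-filter-odd g xs)

oddCount : ℕ → ℕ
oddCount n = sum (map (λ w → f w % 2) (F n))

oddCount-recurrence : ∀ n → oddCount (suc (suc n)) ≡ oddCount (suc n) + (suc n % 2) * oddCount n
oddCount-recurrence n = begin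
  sum (map parity (map (one ∷_) (F (suc n)) ++ map (two ∷_) (F n)))
    ≡⟨ cong sum (map-++ parity (map (one ∷_) (F (suc n))) _) ⟩
  sum (map parity (map (one ∷_) (F (suc n))) ++ map parity (map (two ∷_) (F n)))
    ≡⟨ sum-++ (map parity (map (one ∷_) (F (suc n)))) _ ⟩
  sum (map parity (map (one ∷_) (F (suc n)))) + sum (map parity (map (two ∷_) (F n)))
    ≡⟨ cong₂ (λ us vs → sum us + sum vs) (map-∘ (F (suc n))) (map-∘ (F n)) ⟨
  sum (map (parity ∘ (one ∷_)) (F (suc n))) + sum (map (parity ∘ (two ∷_)) (F n))
    ≡⟨ cong₂ (λ us vs → sum us + sum vs)
         (map-cong (λ w → cong (_% 2) (f-one w)) (F (suc n)))
         (map-cong-local (All.map (λ {w} → parity-two w) (F-weight n))) ⟩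
  oddCount (suc n) + sum (map (λ w → (suc n % 2) * parity w) (F n))
    ≡⟨ cong (oddCount (suc n) +_) (sum-map-*ˡ (suc n % 2) parity (F n)) ⟩
  oddCount (suc n) + (suc n % 2) * oddCount n ∎
  where
  parity : Word → ℕ
  parity w = f w % 2

  parity-two : ∀ w → weight w ≡ n → parity (two ∷ w) ≡ (suc n % 2) * parity w
  parity-two w refl = trans (cong (_% 2) (f-two w)) ([m*n]%2≡[m%2]*[n%2] (suc (weight w)) (f w))

oddCount-pair : ∀ k → oddCount (k * 2) ≡ 2 ^ k × oddCount (suc (k * 2)) ≡ 2 ^ k
oddCount-pair zero    = refl , refl
oddCount-pair (suc k) = even , odd
  where
  ih-even : oddCount (k * 2) ≡ 2 ^ k
  ih-even = proj₁ (oddCount-pair k)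

  ih-odd : oddCount (suc (k * 2)) ≡ 2 ^ k
  ih-odd = proj₂ (oddCount-pair k)

  even : oddCount (suc k * 2) ≡ 2 ^ suc k
  even = begin
    oddCount (suc (suc (k * 2)))
      ≡⟨ oddCount-recurrence (k * 2) ⟩
    oddCount (suc (k * 2)) + (suc (k * 2) % 2) * oddCount (k * 2)
      ≡⟨ cong₂ (λ a b → a + b * oddCount (k * 2)) ih-odd ([m+kn]%n≡m%n 1 k 2) ⟩
    2 ^ k + (oddCount (k * 2) + 0)
      ≡⟨ cong (λ a → 2 ^ k + (a + 0)) ih-even ⟩
    2 ^ suc k ∎

  odd : oddCount (suc (suc k * 2)) ≡ 2 ^ suc k
  odd = begin
    oddCount (suc (suc (suc (k * 2))))
      ≡⟨ oddCount-recurrence (suc (k * 2)) ⟩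
    oddCount (suc k * 2) + (suc k * 2 % 2) * oddCount (suc (k * 2))
      ≡⟨ cong₂ (λ a b → a + b * oddCount (suc (k * 2))) even (m*n%n≡0 (suc k) 2) ⟩
    2 ^ suc k + 0
      ≡⟨ +-identityʳ (2 ^ suc k) ⟩
    2 ^ suc k ∎

oddCount-half : ∀ n → oddCount n ≡ 2 ^ (n / 2)
oddCount-half n with n % 2 | m%2≡0⊎m%2≡1 n | m≡m%n+[m/n]*n n 2
... | _ | inj₁ refl | n≡k*2   = trans (cong oddCount n≡k*2) (proj₁ (oddCount-pair (n / 2)))
... | _ | inj₂ refl | n≡1+k*2 = trans (cong oddCount n≡1+k*2) (proj₂ (oddCount-pair (n / 2)))

mainTheorem3 : (n : ℕ) → length (filter (λ w → f w % 2 ≟ 1) (F n)) ≡ 2 ^ (n / 2)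
mainTheorem3 n = trans (length-filter-odd f (F n)) (oddCount-half n)
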